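{- Let $n\ge1$ and $m\ge1$ be integers, and let $x=\lfloor n\phi\rfloor F_m+nF_{m-1}-F_{m+1}$. Then $\mathrm{sh}_F(x)=\lfloor n\phi\rfloor F_{m+1}+nF_m-F_{m+2}$.
   Context: $F_i$ are the Fibonacci numbers ($F_0=0,F_1=1,F_{m+1}=F_m+F_{m-1}$), $\phi=(1+\sqrt5)/2$. Every positive integer $x$ has a unique Zeckendorf representation $x=\sum_{i\in S}F_i$ with all indices $i\ge2$ and no two consecutive; the Zeckendorf shift is $\mathrm{sh}_F(x)=\sum_{i\in S}F_{i+1}$, with $\mathrm{sh}_F(0)=0$. -}

module Defs where

open import Data.Nat using (ℕ; zero; suc; _+_; _*_; _∸_; _^_; _≤_; _<_)
open import Data.List using (List; []; _∷_)
open import Data.Product using (_×_; Σ; _,_)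
open import Data.Sum using (_⊎_)
open import Data.Unit using (⊤)
open import Relation.Binary.PropositionalEquality using (_≡_)

F : ℕ → ℕ
F zero = 0
F (suc zero) = 1
F (suc (suc m)) = F (suc m) + F m

-- φ = (1 + √5)/2.  For naturals a, n:
--   a ≤ n·φ  ⇔  2a − n ≤ √5·n  ⇔  2a ≤ n  or  (2a − n)² ≤ 5n²
LeNPhi : ℕ → ℕ → Set
LeNPhi a n = (2 * a ≤ n) ⊎ ((2 * a ∸ n) ^ 2 ≤ 5 * n ^ 2)

--   n·φ < b  ⇔  √5·n < 2b − n  ⇔  n < 2b  and  5n² < (2b − n)²
LtNPhi : ℕ → ℕ → Set
LtNPhi n b = (n < 2 * b) × (5 * n ^ 2 < (2 * b ∸ n) ^ 2)

IsFloorNPhi : ℕ → ℕ → Set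
IsFloorNPhi n k = LeNPhi k n × LtNPhi n (suc k)

IsZeckIdx : List ℕ → Set
IsZeckIdx [] = ⊤
IsZeckIdx (i ∷ []) = 2 ≤ i
IsZeckIdx (i ∷ j ∷ rest) = (2 + j ≤ i) × IsZeckIdx (j ∷ rest)

sumF : List ℕ → ℕ
sumF [] = 0
sumF (i ∷ S) = F i + sumF S

sumFShift : List ℕ → ℕ
sumFShift [] = 0
sumFShift (i ∷ S) = F (suc i) + sumFShift S

-- ShF x y  :⇔  sh_F(x) = y : the Zeckendorf representation S of x
-- (unique, by Zeckendorf's theorem) satisfies Σ_{i∈S} F_{i+1} = y.
-- For x = 0 the representation is empty, giving sh_F(0) = 0.
ShF : ℕ → ℕ → Set
ShF x y = Σ (List ℕ) λ S → IsZeckIdx S × (sumF S ≡ x) × (sumFShift S ≡ y)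

-- Write n = x + 1 and let S be the Zeckendorf index set of x, y = sh_F(x). By d'Ocagne's identity
-- y F(M) − x F(M+1) = Σ_{i ∈ S} (−1)^i F(M − i), and since the indices are ≥ 2 and pairwise
-- non-adjacent this lies strictly between −F(M − 2) and F(M − 1).  Comparing with the convergents
-- F(M+1)/F(M), which by Cassini's identity lie below φ for odd M and above φ for even M, squeezes
-- (x + 1)φ strictly between y + 1 and y + 2, so ⌊nφ⌋ = y + 1.  The two sides of the theorem are then
-- F(m) y + F(m−1) x and F(m+1) y + F(m) x, and adding m to every index of S turns a representation
-- of x into one of the former whose shift is the latter.

module Submission where

open import Defs
open import Data.Nat using (ℕ; zero; suc; _+_; _*_; _∸_; _≤_; _<_; _^_; s≤s; s≤s⁻¹; z≤n; _≤?_; _<?_)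
open import Data.Nat.Properties
open import Data.Nat.Tactic.RingSolver using (solve-∀)
open import Data.List using (List; []; _∷_; map)
open import Data.Product using (_×_; Σ; _,_; proj₁; proj₂)
open import Data.Sum using (inj₁; inj₂; [_,_]′)
open import Data.Unit using (⊤; tt)
open import Data.Empty using (⊥-elim)
open import Relation.Binary.PropositionalEquality
open import Relation.Nullary using (yes; no)
open import Data.Integer using (ℤ; +_)
import Data.Integer as ℤ
import Data.Integer.Properties as ℤₚ
import Data.Integer.Tactic.RingSolver as ℤ-Solver

F[1+n]>0 : ∀ n → 0 < F (suc n)
F[1+n]>0 zero = s≤s z≤n
F[1+n]>0 (suc n) = ≤-trans (F[1+n]>0 n) (m≤m+n _ _)

F-mono-≤ : ∀ {m n} → m ≤ n → F m ≤ F n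
F-mono-≤ {n = zero} z≤n = ≤-refl
F-mono-≤ {m} {suc n} m≤1+n with m≤n⇒m<n∨m≡n m≤1+n
... | inj₂ refl = ≤-refl
... | inj₁ (s≤s m≤n) = ≤-trans (F-mono-≤ m≤n) (F-step n)
  where
  F-step : ∀ n → F n ≤ F (suc n)
  F-step zero = z≤n
  F-step (suc n) = m≤m+n _ _

n<F[2+n] : ∀ n → n < F (suc (suc n))
n<F[2+n] zero = s≤s z≤n
n<F[2+n] (suc n) = subst (_≤ F (suc (suc (suc n)))) (+-comm (suc n) 1)
  (+-mono-≤ (n<F[2+n] n) (F[1+n]>0 n))

F-+ : ∀ a b → F (suc (a + b)) ≡ F (suc a) * F (suc b) + F a * F b
F-+ zero b = sym (trans (+-identityʳ _) (+-identityʳ _))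
F-+ (suc zero) b = sym (cong₂ _+_ (+-identityʳ (F (suc b))) (+-identityʳ (F b)))
F-+ (suc (suc a)) b =
  trans (cong₂ _+_ (F-+ (suc a) b) (F-+ a b)) (regroup (F (suc a)) (F a) (F (suc b)) (F b))
  where
  regroup : ∀ p q r s → (p + q) * r + p * s + (p * r + q * s) ≡ (p + q + p) * r + (p + q) * s
  regroup = solve-∀

ZeckBelow : ℕ → List ℕ → Set
ZeckBelow u [] = ⊤
ZeckBelow u (i ∷ S) = 2 ≤ i × 2 + i ≤ u × ZeckBelow i S

ZeckBelow-suc : ∀ {u} S → ZeckBelow u S → ZeckBelow (suc u) S
ZeckBelow-suc [] _ = tt
ZeckBelow-suc (i ∷ S) (2≤i , i+2≤u , z) = 2≤i , m≤n⇒m≤1+n i+2≤u , z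

ZeckBelow⇒IsZeckIdx : ∀ {u} S → ZeckBelow u S → IsZeckIdx S
ZeckBelow⇒IsZeckIdx [] _ = tt
ZeckBelow⇒IsZeckIdx (i ∷ []) (2≤i , _) = 2≤i
ZeckBelow⇒IsZeckIdx (i ∷ j ∷ S) (_ , _ , z@(_ , j+2≤i , _)) = j+2≤i , ZeckBelow⇒IsZeckIdx (j ∷ S) z

ZeckRep : ℕ → ℕ → Set
ZeckRep u x = Σ (List ℕ) λ S → ZeckBelow u S × sumF S ≡ x

zeckendorf : ∀ N x → x < F N → ZeckRep (suc N) x
zeckendorf (suc zero) zero _ = [] , tt , refl
zeckendorf (suc zero) (suc x) (s≤s ())
zeckendorf (suc (suc zero)) zero _ = [] , tt , refl
zeckendorf (suc (suc zero)) (suc x) (s≤s ())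
zeckendorf (suc (suc (suc N))) x x<F =
  [ (λ x<F′ → raiseBound (zeckendorf (suc (suc N)) x x<F′))
  , (λ F≤x → prepend F≤x (zeckendorf (suc N) (x ∸ F (suc (suc N))) (rest<F F≤x)))
  ]′ (<-≤-connex x (F (suc (suc N))))
  where
  raiseBound : ZeckRep (3 + N) x → ZeckRep (4 + N) x
  raiseBound (S , z , sum≡x) = S , ZeckBelow-suc S z , sum≡x

  rest<F : F (suc (suc N)) ≤ x → x ∸ F (suc (suc N)) < F (suc N)
  rest<F F≤x = +-cancelʳ-< (F (suc (suc N))) _ _
    (subst₂ _<_ (sym (m∸n+n≡m F≤x)) (+-comm (F (suc (suc N))) (F (suc N))) x<F)

  prepend : F (suc (suc N)) ≤ x → ZeckRep (2 + N) (x ∸ F (suc (suc N))) → ZeckRep (4 + N) x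
  prepend F≤x (S , z , sum≡rest) = suc (suc N) ∷ S , (s≤s (s≤s z≤n) , ≤-refl , z) ,
    trans (cong (_+_ (F (suc (suc N)))) sum≡rest) (m+[n∸m]≡n F≤x)

IsZeckIdx-map-+ : ∀ m S → IsZeckIdx S → IsZeckIdx (map (_+ m) S)
IsZeckIdx-map-+ m [] _ = tt
IsZeckIdx-map-+ m (i ∷ []) 2≤i = ≤-trans 2≤i (m≤m+n i m)
IsZeckIdx-map-+ m (i ∷ j ∷ S) (j+2≤i , z) =
  subst (_≤ i + m) (+-assoc 2 j m) (+-monoˡ-≤ m j+2≤i) , IsZeckIdx-map-+ m (j ∷ S) z

sumF-map-+ : ∀ m S → sumF (map (_+ suc m) S) ≡ F (suc m) * sumFShift S + F m * sumF S
sumF-map-+ m [] = sym (cong₂ _+_ (*-zeroʳ (F (suc m))) (*-zeroʳ (F m)))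
sumF-map-+ m (i ∷ S) = begin
  F (i + suc m) + sumF (map (_+ suc m) S)
    ≡⟨ cong₂ _+_ (trans (cong F (+-suc i m)) (F-+ i m)) (sumF-map-+ m S) ⟩
  (F (suc i) * F (suc m) + F i * F m) + (F (suc m) * sumFShift S + F m * sumF S)
    ≡⟨ regroup (F (suc i)) (F i) (F (suc m)) (F m) (sumFShift S) (sumF S) ⟩
  F (suc m) * (F (suc i) + sumFShift S) + F m * (F i + sumF S) ∎
  where
  open ≡-Reasoning
  regroup : ∀ a b c d y x → (a * c + b * d) + (c * y + d * x) ≡ c * (a + y) + d * (b + x)
  regroup = solve-∀

sumFShift-map-+ : ∀ m S → sumFShift (map (_+ m) S) ≡ sumF (map (_+ suc m) S)
sumFShift-map-+ m [] = refl
sumFShift-map-+ m (i ∷ S) = cong₂ _+_ (cong F (sym (+-suc i m))) (sumFShift-map-+ m S)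

ShF-reindex : ∀ {x y} → ShF x y → ∀ m →
  ShF (F (suc m) * y + F m * x) (F (suc (suc m)) * y + F (suc m) * x)
ShF-reindex {x} {y} (S , zeck , sum≡x , shift≡y) m =
  map (_+ suc m) S , IsZeckIdx-map-+ (suc m) S zeck ,
  trans (sumF-map-+ m S) (cong₂ (λ p q → F (suc m) * p + F m * q) shift≡y sum≡x) ,
  trans (sumFShift-map-+ (suc m) S)
    (trans (sumF-map-+ (suc m) S) (cong₂ (λ p q → F (suc (suc m)) * p + F (suc m) * q) shift≡y sum≡x))

-- a ≤ nφ and nφ < b, as φ is the positive root of t² = t + 1.
QuadLeNPhi : ℕ → ℕ → Set
QuadLeNPhi a n = a * a ≤ n * a + n * n

QuadLtNPhi : ℕ → ℕ → Set
QuadLtNPhi n b = n * b + n * n < b * b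

m^2≡m*m : ∀ m → m ^ 2 ≡ m * m
m^2≡m*m m = cong (m *_) (*-identityʳ m)

-- With w = 2a − n, the sign of a² − na − n² is that of w² − 5n².
quad-identity : ∀ a n w → w + n ≡ 2 * a → 4 * (a * a) + 5 * (n * n) ≡ w * w + 4 * (n * a + n * n)
quad-identity a n w w+n≡2a = begin
  4 * (a * a) + 5 * (n * n)                  ≡⟨ expand₁ a n ⟩
  (2 * a) * (2 * a) + 5 * (n * n)            ≡⟨ cong (λ t → t * t + 5 * (n * n)) (sym w+n≡2a) ⟩
  (w + n) * (w + n) + 5 * (n * n)            ≡⟨ expand₂ w n ⟩
  w * w + 2 * n * (w + n) + 4 * (n * n)      ≡⟨ cong (λ t → w * w + 2 * n * t + 4 * (n * n)) w+n≡2a ⟩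
  w * w + 2 * n * (2 * a) + 4 * (n * n)      ≡⟨ expand₃ w n a ⟩
  w * w + 4 * (n * a + n * n)                ∎
  where
  open ≡-Reasoning
  expand₁ : ∀ x y → 4 * (x * x) + 5 * (y * y) ≡ (2 * x) * (2 * x) + 5 * (y * y)
  expand₁ = solve-∀
  expand₂ : ∀ x y → (x + y) * (x + y) + 5 * (y * y) ≡ x * x + 2 * y * (x + y) + 4 * (y * y)
  expand₂ = solve-∀
  expand₃ : ∀ x y z → x * x + 2 * y * (2 * z) + 4 * (y * y) ≡ x * x + 4 * (y * z + y * y)
  expand₃ = solve-∀

LeNPhi⇒QuadLeNPhi : ∀ {a n} → LeNPhi a n → QuadLeNPhi a n
LeNPhi⇒QuadLeNPhi {a} {n} (inj₁ 2a≤n) =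
  ≤-trans (*-monoˡ-≤ a (≤-trans (m≤m+n a (a + 0)) 2a≤n)) (m≤m+n (n * a) (n * n))
LeNPhi⇒QuadLeNPhi {a} {n} (inj₂ w²≤5n²) with 2 * a ≤? n
... | yes 2a≤n = LeNPhi⇒QuadLeNPhi (inj₁ 2a≤n)
... | no 2a≰n = *-cancelˡ-≤ 4 (+-cancelʳ-≤ (5 * (n * n)) _ _ (begin
  4 * (a * a) + 5 * (n * n)          ≡⟨ quad-identity a n w (m∸n+n≡m (<⇒≤ (≰⇒> 2a≰n))) ⟩
  w * w + 4 * (n * a + n * n)        ≤⟨ +-monoˡ-≤ _ (subst₂ _≤_ (m^2≡m*m w) (cong (5 *_) (m^2≡m*m n)) w²≤5n²) ⟩
  5 * (n * n) + 4 * (n * a + n * n)  ≡⟨ +-comm (5 * (n * n)) _ ⟩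
  4 * (n * a + n * n) + 5 * (n * n)  ∎))
  where
  open ≤-Reasoning
  w = 2 * a ∸ n

LtNPhi⇒QuadLtNPhi : ∀ {n b} → LtNPhi n b → QuadLtNPhi n b
LtNPhi⇒QuadLtNPhi {n} {b} (n<2b , 5n²<w²) = *-cancelˡ-< 4 _ _ (+-cancelʳ-< (5 * (n * n)) _ _ (begin-strict
  4 * (n * b + n * n) + 5 * (n * n)  ≡⟨ +-comm _ (5 * (n * n)) ⟩
  5 * (n * n) + 4 * (n * b + n * n)  <⟨ +-monoˡ-< _ (subst₂ _<_ (cong (5 *_) (m^2≡m*m n)) (m^2≡m*m w) 5n²<w²) ⟩
  w * w + 4 * (n * b + n * n)        ≡⟨ quad-identity b n w (m∸n+n≡m (<⇒≤ n<2b)) ⟨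
  4 * (b * b) + 5 * (n * n)          ∎))
  where
  open ≤-Reasoning
  w = 2 * b ∸ n

square-sub-mono : ∀ {P X Y} → P ≤ X → X ≤ Y → X * X + Y * P ≤ Y * Y + X * P
square-sub-mono {P} {X} {Y} P≤X X≤Y with m≤n⇒∃[o]m+o≡n X≤Y
... | t , refl = begin
  X * X + (X + t) * P          ≡⟨ lhs X t P ⟩
  X * X + X * P + t * P        ≤⟨ +-monoʳ-≤ (X * X + X * P) tP≤ ⟩
  X * X + X * P + (t * X + t * (X + t)) ≡⟨ rhs X t P ⟩
  (X + t) * (X + t) + X * P    ∎
  where
  open ≤-Reasoning
  tP≤ : t * P ≤ t * X + t * (X + t)
  tP≤ = ≤-trans (*-monoʳ-≤ t P≤X) (m≤m+n (t * X) (t * (X + t)))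
  lhs : ∀ x y z → x * x + (x + y) * z ≡ x * x + x * z + y * z
  lhs = solve-∀
  rhs : ∀ x y z → x * x + x * z + (y * x + y * (x + y)) ≡ (x + y) * (x + y) + x * z
  rhs = solve-∀

QuadLtNPhi⇒≤ : ∀ {c d} → QuadLtNPhi c d → c ≤ d
QuadLtNPhi⇒≤ {c} {d} cd+c²<d² with c ≤? d
... | yes c≤d = c≤d
... | no c≰d = ⊥-elim (<-irrefl refl (<-≤-trans cd+c²<d²
  (≤-trans (*-monoˡ-≤ d (<⇒≤ (≰⇒> c≰d))) (m≤m+n (c * d) (c * c)))))

-- If ad ≤ bc, then with P = ac, X = ad, Y = bc we get X² − XP > P² ≥ Y² − YP,
-- contradicting P ≤ X ≤ Y and the monotonicity of t ↦ t² − tP.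
QuadLeNPhi-QuadLtNPhi⇒< : ∀ {a b c d} → 0 < a → QuadLeNPhi b a → QuadLtNPhi c d → b * c < a * d
QuadLeNPhi-QuadLtNPhi⇒< {a@(suc _)} {b} {c} {d} _ b²≤ab+a² cd+c²<d² with b * c <? a * d
... | yes bc<ad = bc<ad
... | no bc≮ad = ⊥-elim (<-irrefl refl (begin-strict
  X * X + Y * P   ≤⟨ square-sub-mono (*-monoʳ-≤ a (QuadLtNPhi⇒≤ cd+c²<d²)) (≮⇒≥ bc≮ad) ⟩
  Y * Y + X * P   ≤⟨ +-monoˡ-≤ (X * P) Y²≤YP+P² ⟩
  Y * P + P * P + X * P  ≡⟨ swap (Y * P) (P * P) (X * P) ⟩
  Y * P + (X * P + P * P) <⟨ +-monoʳ-< (Y * P) XP+P²<X² ⟩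
  Y * P + X * X   ≡⟨ +-comm (Y * P) (X * X) ⟩
  X * X + Y * P   ∎))
  where
  open ≤-Reasoning
  P = a * c
  X = a * d
  Y = b * c
  XP+P²<X² : X * P + P * P < X * X
  XP+P²<X² = subst₂ _<_ (scale₁ a c d) (scale₂ a d) (*-monoʳ-< (a * a) cd+c²<d²)
    where
    scale₁ : ∀ x y z → x * x * (y * z + y * y) ≡ x * z * (x * y) + x * y * (x * y)
    scale₁ = solve-∀
    scale₂ : ∀ x z → x * x * (z * z) ≡ x * z * (x * z)
    scale₂ = solve-∀
  Y²≤YP+P² : Y * Y ≤ Y * P + P * P
  Y²≤YP+P² = subst₂ _≤_ (scale₁ b c) (scale₂ a b c) (*-monoʳ-≤ (c * c) b²≤ab+a²)
    where
    scale₁ : ∀ y z → z * z * (y * y) ≡ y * z * (y * z)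
    scale₁ = solve-∀
    scale₂ : ∀ x y z → z * z * (x * y + x * x) ≡ y * z * (x * z) + x * z * (x * z)
    scale₂ = solve-∀
  swap : ∀ p q r → p + q + r ≡ p + (r + q)
  swap p q r = trans (+-assoc p q r) (cong (_+_ p) (+-comm q r))

cassini-even⇒odd : ∀ a b → suc (a * b + a * a) ≡ b * b → suc ((b + a) * (b + a)) ≡ b * (b + a) + b * b
cassini-even⇒odd a b e = trans (expand a b) (cong (_+_ (b * (b + a))) e)
  where
  expand : ∀ x y → suc ((y + x) * (y + x)) ≡ y * (y + x) + suc (x * y + x * x)
  expand = solve-∀

cassini-odd⇒even : ∀ a b → suc (b * b) ≡ a * b + a * a → suc (b * (b + a) + b * b) ≡ (b + a) * (b + a)
cassini-odd⇒even a b e = trans (expand a b) (trans (cong (_+_ (b * (b + a))) e) (collect a b))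
  where
  expand : ∀ x y → suc (y * (y + x) + y * y) ≡ y * (y + x) + suc (y * y)
  expand = solve-∀
  collect : ∀ x y → y * (y + x) + (x * y + x * x) ≡ (y + x) * (y + x)
  collect = solve-∀

F-cassini-even : ∀ j → suc (F (j * 2) * F (suc (j * 2)) + F (j * 2) * F (j * 2)) ≡
  F (suc (j * 2)) * F (suc (j * 2))
F-cassini-odd : ∀ j → suc (F (suc (suc (j * 2))) * F (suc (suc (j * 2)))) ≡
  F (suc (j * 2)) * F (suc (suc (j * 2))) + F (suc (j * 2)) * F (suc (j * 2))

F-cassini-even zero = refl
F-cassini-even (suc j) = cassini-odd⇒even (F (suc (j * 2))) (F (suc (suc (j * 2)))) (F-cassini-odd j)
F-cassini-odd j = cassini-even⇒odd (F (j * 2)) (F (suc (j * 2))) (F-cassini-even j)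

F[2j+2]≤F[2j+1]φ : ∀ j → QuadLeNPhi (F (suc (suc (j * 2)))) (F (suc (j * 2)))
F[2j+2]≤F[2j+1]φ j = subst (F (suc (suc (j * 2))) * F (suc (suc (j * 2))) ≤_) (F-cassini-odd j) (n≤1+n _)

F[2j]φ<F[2j+1] : ∀ j → QuadLtNPhi (F (j * 2)) (F (suc (j * 2)))
F[2j]φ<F[2j+1] j = ≤-reflexive (F-cassini-even j)

+[a*b]-+[c*d] : ∀ a b c d → + (a * b) ℤ.- + (c * d) ≡ + a ℤ.* + b ℤ.- + c ℤ.* + d
+[a*b]-+[c*d] a b c d = cong₂ ℤ._-_ (ℤₚ.pos-* a b) (ℤₚ.pos-* c d)

F-dOcagne : ∀ i t → + (F (suc i) * F (i + t)) ℤ.- + (F i * F (suc (i + t))) ≡ ℤ.-1ℤ ℤ.^ i ℤ.* + F t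
F-dOcagne zero t =
  trans (cong +_ (trans (+-identityʳ _) (*-identityˡ (F t)))) (sym (ℤₚ.*-identityˡ (+ F t)))
F-dOcagne (suc i) t = begin
  + ((A + B) * C) ℤ.- + (A * (C + E))          ≡⟨ +[a*b]-+[c*d] (A + B) C A (C + E) ⟩
  + (A + B) ℤ.* + C ℤ.- + A ℤ.* + (C + E)      ≡⟨ cong₂ (λ p q → p ℤ.* + C ℤ.- + A ℤ.* q) (ℤₚ.pos-+ A B) (ℤₚ.pos-+ C E) ⟩
  (+ A ℤ.+ + B) ℤ.* + C ℤ.- + A ℤ.* (+ C ℤ.+ + E) ≡⟨ flip-sign (+ A) (+ B) (+ C) (+ E) ⟩
  ℤ.- (+ A ℤ.* + E ℤ.- + B ℤ.* + C)             ≡⟨ cong ℤ.-_ (trans (sym (+[a*b]-+[c*d] A E B C)) (F-dOcagne i t)) ⟩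
  ℤ.- (ℤ.-1ℤ ℤ.^ i ℤ.* + F t)                   ≡⟨ ℤₚ.neg-distribˡ-* (ℤ.-1ℤ ℤ.^ i) (+ F t) ⟩
  ℤ.- (ℤ.-1ℤ ℤ.^ i) ℤ.* + F t                   ≡⟨ cong (ℤ._* + F t) (sym (ℤₚ.-1*i≡-i (ℤ.-1ℤ ℤ.^ i))) ⟩
  ℤ.-1ℤ ℤ.^ suc i ℤ.* + F t                     ∎
  where
  open ≡-Reasoning
  A = F (suc i)
  B = F i
  C = F (suc (i + t))
  E = F (i + t)
  flip-sign : ∀ a b c e → (a ℤ.+ b) ℤ.* c ℤ.- a ℤ.* (c ℤ.+ e) ≡ ℤ.- (a ℤ.* e ℤ.- b ℤ.* c)
  flip-sign = ℤ-Solver.solve-∀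

-- Compares sumFShift S / sumF S with the convergent F(M+1)/F(M) of φ.
gap : ℕ → List ℕ → ℤ
gap M S = + (sumFShift S * F M) ℤ.- + (sumF S * F (suc M))

gapTerm : ℕ → ℕ → ℤ
gapTerm M i = + (F (suc i) * F M) ℤ.- + (F i * F (suc M))

gap-∷ : ∀ M i S → gap M (i ∷ S) ≡ gapTerm M i ℤ.+ gap M S
gap-∷ M i S = begin
  + ((F (suc i) + y) * F M) ℤ.- + ((F i + x) * F (suc M))
    ≡⟨ cong₂ (λ p q → + p ℤ.- + q) (*-distribʳ-+ (F M) (F (suc i)) y) (*-distribʳ-+ (F (suc M)) (F i) x) ⟩
  + (F (suc i) * F M + y * F M) ℤ.- + (F i * F (suc M) + x * F (suc M))
    ≡⟨ cong₂ ℤ._-_ (ℤₚ.pos-+ (F (suc i) * F M) (y * F M)) (ℤₚ.pos-+ (F i * F (suc M)) (x * F (suc M))) ⟩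
  (+ (F (suc i) * F M) ℤ.+ + (y * F M)) ℤ.- (+ (F i * F (suc M)) ℤ.+ + (x * F (suc M)))
    ≡⟨ regroup (+ (F (suc i) * F M)) (+ (y * F M)) (+ (F i * F (suc M))) (+ (x * F (suc M))) ⟩
  gapTerm M i ℤ.+ gap M S ∎
  where
  open ≡-Reasoning
  x = sumF S
  y = sumFShift S
  regroup : ∀ p q r s → (p ℤ.+ q) ℤ.- (r ℤ.+ s) ≡ (p ℤ.- r) ℤ.+ (q ℤ.- s)
  regroup = ℤ-Solver.solve-∀

gapTerm-dOcagne : ∀ {i M} → i ≤ M → gapTerm M i ≡ ℤ.-1ℤ ℤ.^ i ℤ.* + F (M ∸ i)
gapTerm-dOcagne {i} {M} i≤M =
  subst (λ N → gapTerm N i ≡ ℤ.-1ℤ ℤ.^ i ℤ.* + F (M ∸ i))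
    (m+[n∸m]≡n i≤M) (F-dOcagne i (M ∸ i))

-1^i*+a-bounds : ∀ i a → (ℤ.-1ℤ ℤ.^ i ℤ.* + a ℤ.≤ + a) × (ℤ.- (ℤ.-1ℤ ℤ.^ i ℤ.* + a) ℤ.≤ + a)
-1^i*+a-bounds zero a = ℤₚ.≤-reflexive (ℤₚ.*-identityˡ (+ a)) ,
  subst (λ t → ℤ.- t ℤ.≤ + a) (sym (ℤₚ.*-identityˡ (+ a))) ℤₚ.neg-≤-pos
-1^i*+a-bounds (suc i) a with -1^i*+a-bounds i a
... | up , down = subst (ℤ._≤ + a) (sym flip) down ,
  subst (ℤ._≤ + a) (sym (trans (cong ℤ.-_ flip) (ℤₚ.neg-involutive _))) up
  where
  flip : ℤ.-1ℤ ℤ.^ suc i ℤ.* + a ≡ ℤ.- (ℤ.-1ℤ ℤ.^ i ℤ.* + a)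
  flip = trans (ℤₚ.*-assoc ℤ.-1ℤ (ℤ.-1ℤ ℤ.^ i) (+ a)) (ℤₚ.-1*i≡-i _)

F-∸-rec : ∀ {i M} → i < M → F (suc M ∸ i) ≡ F (M ∸ i) + F (M ∸ suc i)
F-∸-rec {i} {suc M} (s≤s i≤M) rewrite +-∸-assoc 1 (m≤n⇒m≤1+n i≤M) | +-∸-assoc 1 i≤M = refl

-- The index i of a Zeckendorf term contributes ±F(M − i) to the gap; its slack F(M − i − 1)
-- together with it makes up F(M + 1 − i), the slack for the remaining terms.
absorb-term : ∀ {M i u} (t g : ℤ) → t ℤ.≤ + F (M ∸ i) → 2 + i ≤ u → i < M →
  (t ℤ.+ g) ℤ.+ + F (suc M ∸ u) ℤ.≤ g ℤ.+ + F (suc M ∸ i)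
absorb-term {M} {i} {u} t g t≤F i+2≤u i<M = begin
  (t ℤ.+ g) ℤ.+ + F (suc M ∸ u)
    ≤⟨ ℤₚ.+-mono-≤ (ℤₚ.+-monoˡ-≤ g t≤F) (ℤ.+≤+ (F-mono-≤ (∸-monoʳ-≤ (suc M) i+2≤u))) ⟩
  (+ F (M ∸ i) ℤ.+ g) ℤ.+ + F (M ∸ suc i)
    ≡⟨ regroup (+ F (M ∸ i)) g (+ F (M ∸ suc i)) ⟩
  g ℤ.+ (+ F (M ∸ i) ℤ.+ + F (M ∸ suc i))
    ≡⟨ cong (ℤ._+_ g) (trans (sym (ℤₚ.pos-+ (F (M ∸ i)) (F (M ∸ suc i)))) (cong +_ (sym (F-∸-rec i<M)))) ⟩
  g ℤ.+ + F (suc M ∸ i) ∎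
  where
  open ℤₚ.≤-Reasoning
  regroup : ∀ p q r → (p ℤ.+ q) ℤ.+ r ≡ q ℤ.+ (p ℤ.+ r)
  regroup = ℤ-Solver.solve-∀

ZeckBelow-head< : ∀ {u M i} S → ZeckBelow u (i ∷ S) → u ≤ M → i < M
ZeckBelow-head< S (_ , i+2≤u , _) u≤M = ≤-trans (n≤1+n _) (≤-trans i+2≤u u≤M)

gap-upper : ∀ {M} u S → ZeckBelow u S → 2 ≤ u → u ≤ M →
  gap M S ℤ.+ + F (suc M ∸ u) ℤ.≤ + F (M ∸ 1)
gap-upper {M} u [] _ 2≤u _ = ℤ.+≤+ (F-mono-≤ (∸-monoʳ-≤ (suc M) 2≤u))
gap-upper {M} u (i ∷ S) z@(2≤i , i+2≤u , zS) _ u≤M = begin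
  gap M (i ∷ S) ℤ.+ + F (suc M ∸ u)
    ≡⟨ cong (ℤ._+ + F (suc M ∸ u)) (gap-∷ M i S) ⟩
  (gapTerm M i ℤ.+ gap M S) ℤ.+ + F (suc M ∸ u)
    ≤⟨ absorb-term (gapTerm M i) (gap M S) term≤ i+2≤u i<M ⟩
  gap M S ℤ.+ + F (suc M ∸ i)
    ≤⟨ gap-upper i S zS 2≤i (<⇒≤ i<M) ⟩
  + F (M ∸ 1) ∎
  where
  open ℤₚ.≤-Reasoning
  i<M = ZeckBelow-head< S z u≤M
  term≤ : gapTerm M i ℤ.≤ + F (M ∸ i)
  term≤ = subst (ℤ._≤ + F (M ∸ i)) (sym (gapTerm-dOcagne (<⇒≤ i<M))) (proj₁ (-1^i*+a-bounds i (F (M ∸ i))))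

gap-lower : ∀ {M} u S → ZeckBelow u S → 3 ≤ u → u ≤ M →
  ℤ.- gap M S ℤ.+ + F (suc M ∸ u) ℤ.≤ + F (M ∸ 2)
gap-lower {M} u [] _ 3≤u _ = ℤ.+≤+ (F-mono-≤ (∸-monoʳ-≤ (suc M) 3≤u))
gap-lower {M} u (i ∷ S) z@(2≤i , i+2≤u , zS) _ u≤M with m≤n⇒m<n∨m≡n 2≤i
... | inj₁ 3≤i = begin
  ℤ.- gap M (i ∷ S) ℤ.+ + F (suc M ∸ u)
    ≡⟨ cong (λ t → ℤ.- t ℤ.+ + F (suc M ∸ u)) (gap-∷ M i S) ⟩
  ℤ.- (gapTerm M i ℤ.+ gap M S) ℤ.+ + F (suc M ∸ u)
    ≡⟨ cong (ℤ._+ + F (suc M ∸ u)) (ℤₚ.neg-distrib-+ (gapTerm M i) (gap M S)) ⟩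
  (ℤ.- gapTerm M i ℤ.+ ℤ.- gap M S) ℤ.+ + F (suc M ∸ u)
    ≤⟨ absorb-term (ℤ.- gapTerm M i) (ℤ.- gap M S) -term≤ i+2≤u i<M ⟩
  ℤ.- gap M S ℤ.+ + F (suc M ∸ i)
    ≤⟨ gap-lower i S zS 3≤i (<⇒≤ i<M) ⟩
  + F (M ∸ 2) ∎
  where
  open ℤₚ.≤-Reasoning
  i<M = ZeckBelow-head< S z u≤M
  -term≤ : ℤ.- gapTerm M i ℤ.≤ + F (M ∸ i)
  -term≤ = subst (λ t → ℤ.- t ℤ.≤ + F (M ∸ i)) (sym (gapTerm-dOcagne (<⇒≤ i<M)))
    (proj₂ (-1^i*+a-bounds i (F (M ∸ i))))
-- An index 2 is necessarily the last one, and it contributes +F(M − 2).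
gap-lower {M} u (_ ∷ []) z 3≤u u≤M | inj₂ refl = begin
  ℤ.- gap M (2 ∷ []) ℤ.+ + F (suc M ∸ u)  ≡⟨ cong (λ t → ℤ.- t ℤ.+ + F (suc M ∸ u)) gap≡ ⟩
  ℤ.- + F (M ∸ 2) ℤ.+ + F (suc M ∸ u)     ≤⟨ ℤₚ.+-monoˡ-≤ (+ F (suc M ∸ u)) (ℤₚ.neg-≤-pos {F (M ∸ 2)} {0}) ⟩
  + F (suc M ∸ u)                         ≤⟨ ℤ.+≤+ (F-mono-≤ (∸-monoʳ-≤ (suc M) 3≤u)) ⟩
  + F (M ∸ 2)                             ∎
  where
  open ℤₚ.≤-Reasoning
  gap≡ : gap M (2 ∷ []) ≡ + F (M ∸ 2)
  gap≡ = trans (gap-∷ M 2 []) (trans (ℤₚ.+-identityʳ _)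
    (trans (gapTerm-dOcagne (<⇒≤ (ZeckBelow-head< [] z u≤M))) (ℤₚ.*-identityˡ _)))
gap-lower u (_ ∷ _ ∷ _) (_ , _ , s≤s (s≤s z≤n) , s≤s (s≤s ()) , _) _ _ | inj₂ refl

+a-+b++c≤+d⇒a+c≤d+b : ∀ a b c d → + a ℤ.- + b ℤ.+ + c ℤ.≤ + d → a + c ≤ d + b
+a-+b++c≤+d⇒a+c≤d+b a b c d h = ℤₚ.drop‿+≤+ (subst₂ ℤ._≤_ lhs (sym (ℤₚ.pos-+ d b)) (ℤₚ.+-monoˡ-≤ (+ b) h))
  where
  cancel : ∀ p q r → p ℤ.- q ℤ.+ r ℤ.+ q ≡ p ℤ.+ r
  cancel = ℤ-Solver.solve-∀
  lhs : + a ℤ.- + b ℤ.+ + c ℤ.+ + b ≡ + (a + c)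
  lhs = trans (cancel (+ a) (+ b) (+ c)) (sym (ℤₚ.pos-+ a c))

F[1+M∸u]>0 : ∀ {u M} → u ≤ M → 0 < F (suc M ∸ u)
F[1+M∸u]>0 {u} {M} u≤M = subst (λ t → 0 < F t) (sym (+-∸-assoc 1 u≤M)) (F[1+n]>0 (M ∸ u))

shift-ratio-below : ∀ {u M} S → ZeckBelow u S → 2 ≤ u → u ≤ M →
  suc (sumFShift S) * F M < suc (sumF S) * F (suc M)
shift-ratio-below {M = zero} _ _ (s≤s _) ()
shift-ratio-below {u} {suc M} S z 2≤u u≤M = begin-strict
  F (suc M) + y * F (suc M)                    <⟨ +-monoʳ-< (F (suc M)) y<x ⟩
  F (suc M) + (F M + x * F (suc (suc M)))      ≡⟨ +-assoc (F (suc M)) (F M) _ ⟨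
  F (suc M) + F M + x * F (suc (suc M))        ∎
  where
  open ≤-Reasoning
  x = sumF S
  y = sumFShift S
  y<x : y * F (suc M) < F M + x * F (suc (suc M))
  y<x = <-≤-trans (m<m+n _ (F[1+M∸u]>0 u≤M))
    (+a-+b++c≤+d⇒a+c≤d+b _ _ _ _ (gap-upper u S z 2≤u u≤M))

shift-ratio-above : ∀ {u M} S → ZeckBelow u S → 3 ≤ u → u ≤ M →
  suc (sumF S) * F (suc M) < (2 + sumFShift S) * F M
shift-ratio-above {M = zero} _ _ (s≤s _) ()
shift-ratio-above {M = suc zero} _ _ (s≤s (s≤s _)) (s≤s ())
shift-ratio-above {u} {M@(suc (suc M″))} S z 3≤u u≤M = begin-strict
  F (suc M) + x * F (suc M)                    <⟨ +-monoʳ-< (F (suc M)) x<y ⟩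
  F (suc M) + (F M″ + y * F M)                 ≡⟨ regroup (F (suc M″)) (F M″) (y * F M) ⟩
  F M + (F M + y * F M)                        ∎
  where
  open ≤-Reasoning
  x = sumF S
  y = sumFShift S
  x<y : x * F (suc M) < F M″ + y * F M
  x<y = <-≤-trans (m<m+n _ (F[1+M∸u]>0 u≤M))
    (+a-+b++c≤+d⇒a+c≤d+b _ _ _ _
      (subst (λ t → t ℤ.+ + F (suc M ∸ u) ℤ.≤ + F M″) (neg-minus (+ (y * F M)) (+ (x * F (suc M))))
        (gap-lower u S z 3≤u u≤M)))
    where
    neg-minus : ∀ p q → ℤ.- (p ℤ.- q) ≡ q ℤ.- p
    neg-minus = ℤ-Solver.solve-∀
  regroup : ∀ a b c → (a + b) + a + (b + c) ≡ a + b + ((a + b) + c)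
  regroup = solve-∀

-- Squeeze (x + 1)φ between the convergents F(M+1)/F(M) for M = 2u + 1 (below φ) and M = 2u (above φ).
⌊[1+sumF]φ⌋≡1+sumFShift : ∀ {u k} S → ZeckBelow u S → 3 ≤ u →
  IsFloorNPhi (suc (sumF S)) k → k ≡ suc (sumFShift S)
⌊[1+sumF]φ⌋≡1+sumFShift {u} {k} S z 3≤u (k≤nφ , nφ<1+k) = ≤-antisym k≤1+y 1+y≤k
  where
  x = sumF S
  y = sumFShift S
  odd = suc (u * 2)
  even = u * 2
  u≤even : u ≤ even
  u≤even = m≤m*n u 2

  F[1+odd]/F[odd]<[1+k]/[1+x] : F (suc odd) * suc x < F odd * suc k
  F[1+odd]/F[odd]<[1+k]/[1+x] = QuadLeNPhi-QuadLtNPhi⇒< {F odd} {F (suc odd)} {suc x} {suc k}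
    (F[1+n]>0 even) (F[2j+2]≤F[2j+1]φ u) (LtNPhi⇒QuadLtNPhi nφ<1+k)

  k/[1+x]<F[1+even]/F[even] : k * F even < suc x * F (suc even)
  k/[1+x]<F[1+even]/F[even] = QuadLeNPhi-QuadLtNPhi⇒< {suc x} {k} {F even} {F (suc even)}
    (s≤s z≤n) (LeNPhi⇒QuadLeNPhi k≤nφ) (F[2j]φ<F[2j+1] u)

  1+y≤k : suc y ≤ k
  1+y≤k = s≤s⁻¹ (*-cancelʳ-< (F odd) (suc y) (suc k) (begin-strict
    suc y * F odd              <⟨ shift-ratio-below {u} {odd} S z (≤-trans (n≤1+n 2) 3≤u) (m≤n⇒m≤1+n u≤even) ⟩
    suc x * F (suc odd)        ≡⟨ *-comm (suc x) (F (suc odd)) ⟩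
    F (suc odd) * suc x        <⟨ F[1+odd]/F[odd]<[1+k]/[1+x] ⟩
    F odd * suc k              ≡⟨ *-comm (F odd) (suc k) ⟩
    suc k * F odd              ∎))
    where open ≤-Reasoning

  k≤1+y : k ≤ suc y
  k≤1+y = s≤s⁻¹ (*-cancelʳ-< (F even) k (2 + y) (begin-strict
    k * F even                 <⟨ k/[1+x]<F[1+even]/F[even] ⟩
    suc x * F (suc even)       <⟨ shift-ratio-above {u} {even} S z 3≤u u≤even ⟩
    (2 + y) * F even           ∎))
    where open ≤-Reasoning

⌊[1+x]φ⌋≡1+shF : ∀ x {k} → IsFloorNPhi (suc x) k → Σ ℕ λ y → ShF x y × k ≡ suc y
⌊[1+x]φ⌋≡1+shF x floor with zeckendorf (suc (suc x)) x (n<F[2+n] x)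
... | S , z , refl = sumFShift S , (S , ZeckBelow⇒IsZeckIdx S z , refl , refl) ,
  ⌊[1+sumF]φ⌋≡1+sumFShift S z (s≤s (s≤s (s≤s z≤n))) floor

lemma6 : (n m k : ℕ) → 1 ≤ n → 1 ≤ m → IsFloorNPhi n k →
    ShF (k * F m + n * F (m ∸ 1) ∸ F (suc m))
        (k * F (suc m) + n * F m ∸ F (suc (suc m)))
lemma6 (suc x) (suc m) k _ _ floor =
  let y , shF , k≡1+y = ⌊[1+x]φ⌋≡1+shF x floor in
  subst (λ k → ShF (k * F (suc m) + suc x * F m ∸ F (suc (suc m)))
                   (k * F (suc (suc m)) + suc x * F (suc m) ∸ F (suc (suc (suc m)))))
    (sym k≡1+y)
    (subst₂ ShF (sym (cancel y (F (suc m)) (F m))) (sym (cancel y (F (suc (suc m))) (F (suc m))))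
      (ShF-reindex shF m))
  where
  cancel : ∀ y a b → suc y * a + suc x * b ∸ (a + b) ≡ a * y + b * x
  cancel y a b = trans (cong (_∸ (a + b)) (regroup y x a b)) (m+n∸n≡m _ (a + b))
    where
    regroup : ∀ p q c d → suc p * c + suc q * d ≡ (c * p + d * q) + (c + d)
    regroup = solve-∀
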